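{- The class of hemi-Nelson algebras is a variety.
   Context: A Kleene algebra is a bounded distributive lattice $\langle T,\wedge,\vee,0,1\rangle$ with a unary operation $\sim$ such that $\sim\sim x=x$, $\sim(x\wedge y)=\sim x\vee\sim y$ and $(x\wedge\sim x)\wedge(y\vee\sim y)=x\wedge\sim x$. A hemi-Nelson algebra is an algebra $\langle T,\wedge,\vee,\rightarrow,\sim,0,1\rangle$ of type $(2,2,2,1,0,0)$ such that $\langle T,\wedge,\vee,\sim,0,1\rangle$ is a Kleene algebra and for all $x,y,z\in T$: (hN1) $x\rightarrow x=1$; (hN2) $x\wedge(x\rightarrow y)\le x\wedge(\sim x\vee y)$; (hN3) $\sim(x\rightarrow y)\rightarrow(x\wedge\sim y)=1$; (hN4) $(x\wedge\sim y)\rightarrow\sim(x\rightarrow y)=1$; (hN5) $(x\wedge y\wedge(x\rightarrow y))\rightarrow(x\wedge(x\rightarrow y))=1$; (hN6) $(x\wedge(x\rightarrow y))\rightarrow(x\wedge y\wedge(x\rightarrow y))=1$; (hN7) if $x\rightarrow y=1$, $y\rightarrow x=1$, $y\rightarrow z=1$ and $z\rightarrow y=1$ then $x\rightarrow z=1$ and $z\rightarrow x=1$; (hN8) if $x\rightarrow y=1$ and $y\rightarrow x=1$ then $(x\wedge z)\rightarrow(y\wedge z)=1$; (hN9) if $x\rightarrow y=1$ and $y\rightarrow x=1$ then $(x\vee z)\rightarrow(y\vee z)=1$; (hN10) if $x\rightarrow y=1$ and $y\rightarrow x=1$ then $(x\rightarrow z)\rightarrow(y\rightarrow z)=1$ and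 $(z\rightarrow x)\rightarrow(z\rightarrow y)=1$. -}

module Defs where

open import Data.Nat using (ℕ)
open import Data.Product using (Σ; _×_; _,_)
open import Relation.Binary.PropositionalEquality using (_≡_)
open import Algebra.Core using (Op₁; Op₂)
open import Algebra.Definitions using (Identity)
open import Algebra.Lattice.Structures using (IsDistributiveLattice)

-- Algebras of type (2,2,2,1,0,0): ⟨T, ∧, ∨, →, ∼, 0, 1⟩.
-- Algebras are sets; equality of elements is propositional equality.

record HNStructure : Set₁ where
  infixr 7 _⊓_
  infixr 6 _⊔_
  infixr 5 _⇒_
  field
    Carrier : Set
    _⊓_     : Op₂ Carrier
    _⊔_     : Op₂ Carrier
    _⇒_     : Op₂ Carrier
    ∼_      : Op₁ Carrier
    𝟘       : Carrier
    𝟙       : Carrier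

  _≤_ : Carrier → Carrier → Set
  x ≤ y = x ⊓ y ≡ x

record IsKleene (A : HNStructure) : Set where
  open HNStructure A
  field
    isDistributiveLattice : IsDistributiveLattice {A = Carrier} _≡_ _⊔_ _⊓_
    ⊔-identity            : Identity _≡_ 𝟘 _⊔_
    ⊓-identity            : Identity _≡_ 𝟙 _⊓_
    ∼-invol               : ∀ x → ∼ (∼ x) ≡ x
    ∼-deMorgan            : ∀ x y → ∼ (x ⊓ y) ≡ (∼ x) ⊔ (∼ y)
    kleene                : ∀ x y → (x ⊓ ∼ x) ⊓ (y ⊔ ∼ y) ≡ x ⊓ ∼ x

record IsHemiNelson (A : HNStructure) : Set where
  open HNStructure A
  field
    isKleene : IsKleene A
    hN1  : ∀ x → x ⇒ x ≡ 𝟙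
    hN2  : ∀ x y → (x ⊓ (x ⇒ y)) ≤ (x ⊓ ((∼ x) ⊔ y))
    hN3  : ∀ x y → (∼ (x ⇒ y)) ⇒ (x ⊓ ∼ y) ≡ 𝟙
    hN4  : ∀ x y → (x ⊓ ∼ y) ⇒ (∼ (x ⇒ y)) ≡ 𝟙
    hN5  : ∀ x y → (x ⊓ y ⊓ (x ⇒ y)) ⇒ (x ⊓ (x ⇒ y)) ≡ 𝟙
    hN6  : ∀ x y → (x ⊓ (x ⇒ y)) ⇒ (x ⊓ y ⊓ (x ⇒ y)) ≡ 𝟙
    hN7  : ∀ x y z → x ⇒ y ≡ 𝟙 → y ⇒ x ≡ 𝟙 → y ⇒ z ≡ 𝟙 → z ⇒ y ≡ 𝟙 →
           (x ⇒ z ≡ 𝟙) × (z ⇒ x ≡ 𝟙)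
    hN8  : ∀ x y z → x ⇒ y ≡ 𝟙 → y ⇒ x ≡ 𝟙 → (x ⊓ z) ⇒ (y ⊓ z) ≡ 𝟙
    hN9  : ∀ x y z → x ⇒ y ≡ 𝟙 → y ⇒ x ≡ 𝟙 → (x ⊔ z) ⇒ (y ⊔ z) ≡ 𝟙
    hN10 : ∀ x y z → x ⇒ y ≡ 𝟙 → y ⇒ x ≡ 𝟙 →
           ((x ⇒ z) ⇒ (y ⇒ z) ≡ 𝟙) × ((z ⇒ x) ⇒ (z ⇒ y) ≡ 𝟙)

data Term : Set where
  var       : ℕ → Term
  _∧ₜ_ _∨ₜ_ _→ₜ_ : Term → Term → Term
  ∼ₜ_       : Term → Term
  0ₜ 1ₜ     : Term

Identity′ : Set
Identity′ = Term × Term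

⟦_⟧ : Term → (A : HNStructure) → (ℕ → HNStructure.Carrier A) → HNStructure.Carrier A
⟦ var i ⟧  A ρ = ρ i
⟦ s ∧ₜ t ⟧ A ρ = HNStructure._⊓_ A (⟦ s ⟧ A ρ) (⟦ t ⟧ A ρ)
⟦ s ∨ₜ t ⟧ A ρ = HNStructure._⊔_ A (⟦ s ⟧ A ρ) (⟦ t ⟧ A ρ)
⟦ s →ₜ t ⟧ A ρ = HNStructure._⇒_ A (⟦ s ⟧ A ρ) (⟦ t ⟧ A ρ)
⟦ ∼ₜ s ⟧   A ρ = HNStructure.∼_ A (⟦ s ⟧ A ρ)
⟦ 0ₜ ⟧     A ρ = HNStructure.𝟘 A
⟦ 1ₜ ⟧     A ρ = HNStructure.𝟙 A

_⊨_ : HNStructure → Identity′ → Set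
A ⊨ (s , t) = ∀ (ρ : ℕ → HNStructure.Carrier A) → ⟦ s ⟧ A ρ ≡ ⟦ t ⟧ A ρ

-- A class of algebras (given as a predicate) is a variety: it is an
-- equational class, i.e. there is a set of identities (indexed by some
-- I : Set) whose models are exactly the members of the class.
IsVariety : (HNStructure → Set) → Set₁
IsVariety K =
  Σ Set λ I → Σ (I → Identity′) λ E →
    ∀ (A : HNStructure) → (K A → ∀ i → A ⊨ E i) × ((∀ i → A ⊨ E i) → K A)

{-# OPTIONS --safe #-}
-- hN1–hN6 and the Kleene axioms are identities already; hN7–hN10 are
-- quasi-identities whose hypotheses say x ≋ y, i.e. x → y = 1 = y → x.
-- Write x ⇔ y for (x → y) ∧ (y → x).  In every hemi-Nelson algebra
-- x ∧ (x ⇔ y) ≋ y ∧ (x ⇔ y) holds outright: by hN5, hN6 and hN8 both sides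
-- are ≋ to x ∧ y ∧ (x ⇔ y).  When x ≋ y the guard x ⇔ y is 1, so the
-- guarded terms collapse to x and y.  Hence each quasi-identity is
-- equivalent to the identity obtained from its conclusion by substituting
-- the guarded terms for x and y (and similarly with the guard
-- (x ⇔ y) ∧ (y ⇔ z) for hN7).
module Submission where

open import Defs
open import Algebra.Bundles using (CommutativeSemigroup)
open import Algebra.Lattice.Bundles using (Lattice)
open import Algebra.Lattice.Structures using (IsDistributiveLattice)
import Algebra.Lattice.Properties.Lattice as LatticeProperties
import Algebra.Properties.CommutativeSemigroup as CommutativeSemigroupProperties
open import Algebra.Structures using (IsCommutativeBand)
open import Data.Nat using (ℕ; zero; suc)
open import Data.Product using (_×_; _,_; proj₁; proj₂; swap; uncurry)
open import Data.Sum using (_⊎_; inj₁; inj₂; [_,_])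
open import Function using (_∘_)
open import Relation.Binary.Bundles using (Setoid)
open import Relation.Binary.PropositionalEquality
  using (_≡_; refl; cong; cong₂; subst₂; isEquivalence)
import Relation.Binary.Reasoning.Setoid as SetoidReasoning

xₜ yₜ zₜ : Term
xₜ = var 0
yₜ = var 1
zₜ = var 2

assign : {C : Set} → C → C → C → ℕ → C
assign x y z zero          = x
assign x y z (suc zero)    = y
assign x y z (suc (suc _)) = z

_⇔ₜ_ : Term → Term → Term
s ⇔ₜ t = (s →ₜ t) ∧ₜ (t →ₜ s)

data KleeneAxiom : Set where
  ∨-comm ∨-assoc ∧-comm ∧-assoc ∨-absorbs-∧ ∧-absorbs-∨ : KleeneAxiom
  ∨-distribˡ-∧ ∨-distribʳ-∧ ∧-distribˡ-∨ ∧-distribʳ-∨   : KleeneAxiom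
  ∨-identityˡ ∨-identityʳ ∧-identityˡ ∧-identityʳ       : KleeneAxiom
  ∼-invol ∼-deMorgan kleene                             : KleeneAxiom

kleeneIdentity : KleeneAxiom → Identity′
kleeneIdentity ∨-comm       = xₜ ∨ₜ yₜ , yₜ ∨ₜ xₜ
kleeneIdentity ∨-assoc      = (xₜ ∨ₜ yₜ) ∨ₜ zₜ , xₜ ∨ₜ (yₜ ∨ₜ zₜ)
kleeneIdentity ∧-comm       = xₜ ∧ₜ yₜ , yₜ ∧ₜ xₜ
kleeneIdentity ∧-assoc      = (xₜ ∧ₜ yₜ) ∧ₜ zₜ , xₜ ∧ₜ (yₜ ∧ₜ zₜ)
kleeneIdentity ∨-absorbs-∧  = xₜ ∨ₜ (xₜ ∧ₜ yₜ) , xₜ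
kleeneIdentity ∧-absorbs-∨  = xₜ ∧ₜ (xₜ ∨ₜ yₜ) , xₜ
kleeneIdentity ∨-distribˡ-∧ = xₜ ∨ₜ (yₜ ∧ₜ zₜ) , (xₜ ∨ₜ yₜ) ∧ₜ (xₜ ∨ₜ zₜ)
kleeneIdentity ∨-distribʳ-∧ = (yₜ ∧ₜ zₜ) ∨ₜ xₜ , (yₜ ∨ₜ xₜ) ∧ₜ (zₜ ∨ₜ xₜ)
kleeneIdentity ∧-distribˡ-∨ = xₜ ∧ₜ (yₜ ∨ₜ zₜ) , (xₜ ∧ₜ yₜ) ∨ₜ (xₜ ∧ₜ zₜ)
kleeneIdentity ∧-distribʳ-∨ = (yₜ ∨ₜ zₜ) ∧ₜ xₜ , (yₜ ∧ₜ xₜ) ∨ₜ (zₜ ∧ₜ xₜ)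
kleeneIdentity ∨-identityˡ  = 0ₜ ∨ₜ xₜ , xₜ
kleeneIdentity ∨-identityʳ  = xₜ ∨ₜ 0ₜ , xₜ
kleeneIdentity ∧-identityˡ  = 1ₜ ∧ₜ xₜ , xₜ
kleeneIdentity ∧-identityʳ  = xₜ ∧ₜ 1ₜ , xₜ
kleeneIdentity ∼-invol      = ∼ₜ (∼ₜ xₜ) , xₜ
kleeneIdentity ∼-deMorgan   = ∼ₜ (xₜ ∧ₜ yₜ) , (∼ₜ xₜ) ∨ₜ (∼ₜ yₜ)
kleeneIdentity kleene       = (xₜ ∧ₜ (∼ₜ xₜ)) ∧ₜ (yₜ ∨ₜ (∼ₜ yₜ)) , xₜ ∧ₜ (∼ₜ xₜ)

data HemiNelsonAxiom : Set where
  hN1 hN2 hN3 hN4 hN5 hN6 hN7₁ hN7₂ hN8 hN9 hN10₁ hN10₂ : HemiNelsonAxiom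

hemiNelsonIdentity : HemiNelsonAxiom → Identity′
hemiNelsonIdentity hN1   = xₜ →ₜ xₜ , 1ₜ
hemiNelsonIdentity hN2   = (xₜ ∧ₜ (xₜ →ₜ yₜ)) ∧ₜ (xₜ ∧ₜ ((∼ₜ xₜ) ∨ₜ yₜ)) , xₜ ∧ₜ (xₜ →ₜ yₜ)
hemiNelsonIdentity hN3   = (∼ₜ (xₜ →ₜ yₜ)) →ₜ (xₜ ∧ₜ (∼ₜ yₜ)) , 1ₜ
hemiNelsonIdentity hN4   = (xₜ ∧ₜ (∼ₜ yₜ)) →ₜ (∼ₜ (xₜ →ₜ yₜ)) , 1ₜ
hemiNelsonIdentity hN5   = (xₜ ∧ₜ (yₜ ∧ₜ (xₜ →ₜ yₜ))) →ₜ (xₜ ∧ₜ (xₜ →ₜ yₜ)) , 1ₜ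
hemiNelsonIdentity hN6   = (xₜ ∧ₜ (xₜ →ₜ yₜ)) →ₜ (xₜ ∧ₜ (yₜ ∧ₜ (xₜ →ₜ yₜ))) , 1ₜ
hemiNelsonIdentity hN7₁  = (xₜ ∧ₜ ((xₜ ⇔ₜ yₜ) ∧ₜ (yₜ ⇔ₜ zₜ))) →ₜ (zₜ ∧ₜ ((xₜ ⇔ₜ yₜ) ∧ₜ (yₜ ⇔ₜ zₜ))) , 1ₜ
hemiNelsonIdentity hN7₂  = (zₜ ∧ₜ ((xₜ ⇔ₜ yₜ) ∧ₜ (yₜ ⇔ₜ zₜ))) →ₜ (xₜ ∧ₜ ((xₜ ⇔ₜ yₜ) ∧ₜ (yₜ ⇔ₜ zₜ))) , 1ₜ
hemiNelsonIdentity hN8   = ((xₜ ∧ₜ (xₜ ⇔ₜ yₜ)) ∧ₜ zₜ) →ₜ ((yₜ ∧ₜ (xₜ ⇔ₜ yₜ)) ∧ₜ zₜ) , 1ₜ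
hemiNelsonIdentity hN9   = ((xₜ ∧ₜ (xₜ ⇔ₜ yₜ)) ∨ₜ zₜ) →ₜ ((yₜ ∧ₜ (xₜ ⇔ₜ yₜ)) ∨ₜ zₜ) , 1ₜ
hemiNelsonIdentity hN10₁ = ((xₜ ∧ₜ (xₜ ⇔ₜ yₜ)) →ₜ zₜ) →ₜ ((yₜ ∧ₜ (xₜ ⇔ₜ yₜ)) →ₜ zₜ) , 1ₜ
hemiNelsonIdentity hN10₂ = (zₜ →ₜ (xₜ ∧ₜ (xₜ ⇔ₜ yₜ))) →ₜ (zₜ →ₜ (yₜ ∧ₜ (xₜ ⇔ₜ yₜ))) , 1ₜ

Axiom : Set
Axiom = KleeneAxiom ⊎ HemiNelsonAxiom

axiomIdentity : Axiom → Identity′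
axiomIdentity = [ kleeneIdentity , hemiNelsonIdentity ]

module _ (A : HNStructure) where
  open HNStructure A

  _⇔_ : Carrier → Carrier → Carrier
  x ⇔ y = (x ⇒ y) ⊓ (y ⇒ x)

  module _ (K : IsKleene A) where
    module K = IsKleene K
    module L = IsDistributiveLattice K.isDistributiveLattice

    isKleene⇒⊨kleeneIdentity : ∀ ax → A ⊨ kleeneIdentity ax
    isKleene⇒⊨kleeneIdentity ∨-comm       ρ = L.∨-comm _ _
    isKleene⇒⊨kleeneIdentity ∨-assoc      ρ = L.∨-assoc _ _ _
    isKleene⇒⊨kleeneIdentity ∧-comm       ρ = L.∧-comm _ _
    isKleene⇒⊨kleeneIdentity ∧-assoc      ρ = L.∧-assoc _ _ _
    isKleene⇒⊨kleeneIdentity ∨-absorbs-∧  ρ = L.∨-absorbs-∧ _ _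
    isKleene⇒⊨kleeneIdentity ∧-absorbs-∨  ρ = L.∧-absorbs-∨ _ _
    isKleene⇒⊨kleeneIdentity ∨-distribˡ-∧ ρ = L.∨-distribˡ-∧ _ _ _
    isKleene⇒⊨kleeneIdentity ∨-distribʳ-∧ ρ = L.∨-distribʳ-∧ _ _ _
    isKleene⇒⊨kleeneIdentity ∧-distribˡ-∨ ρ = L.∧-distribˡ-∨ _ _ _
    isKleene⇒⊨kleeneIdentity ∧-distribʳ-∨ ρ = L.∧-distribʳ-∨ _ _ _
    isKleene⇒⊨kleeneIdentity ∨-identityˡ  ρ = proj₁ K.⊔-identity _
    isKleene⇒⊨kleeneIdentity ∨-identityʳ  ρ = proj₂ K.⊔-identity _
    isKleene⇒⊨kleeneIdentity ∧-identityˡ  ρ = proj₁ K.⊓-identity _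
    isKleene⇒⊨kleeneIdentity ∧-identityʳ  ρ = proj₂ K.⊓-identity _
    isKleene⇒⊨kleeneIdentity ∼-invol      ρ = K.∼-invol _
    isKleene⇒⊨kleeneIdentity ∼-deMorgan   ρ = K.∼-deMorgan _ _
    isKleene⇒⊨kleeneIdentity kleene       ρ = K.kleene _ _

  ⊨kleeneIdentity⇒isKleene : (∀ ax → A ⊨ kleeneIdentity ax) → IsKleene A
  ⊨kleeneIdentity⇒isKleene M = record
    { isDistributiveLattice = record
      { isLattice = record
        { isEquivalence = isEquivalence
        ; ∨-comm        = λ x y → M ∨-comm (assign x y y)
        ; ∨-assoc       = λ x y z → M ∨-assoc (assign x y z)
        ; ∨-cong        = cong₂ _⊔_
        ; ∧-comm        = λ x y → M ∧-comm (assign x y y)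
        ; ∧-assoc       = λ x y z → M ∧-assoc (assign x y z)
        ; ∧-cong        = cong₂ _⊓_
        ; absorptive    = (λ x y → M ∨-absorbs-∧ (assign x y y))
                        , (λ x y → M ∧-absorbs-∨ (assign x y y))
        }
      ; ∨-distrib-∧ = (λ x y z → M ∨-distribˡ-∧ (assign x y z))
                    , (λ x y z → M ∨-distribʳ-∧ (assign x y z))
      ; ∧-distrib-∨ = (λ x y z → M ∧-distribˡ-∨ (assign x y z))
                    , (λ x y z → M ∧-distribʳ-∨ (assign x y z))
      }
    ; ⊔-identity = (λ x → M ∨-identityˡ (assign x x x)) , (λ x → M ∨-identityʳ (assign x x x))
    ; ⊓-identity = (λ x → M ∧-identityˡ (assign x x x)) , (λ x → M ∧-identityʳ (assign x x x))
    ; ∼-invol    = λ x → M ∼-invol (assign x x x)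
    ; ∼-deMorgan = λ x y → M ∼-deMorgan (assign x y y)
    ; kleene     = λ x y → M kleene (assign x y y)
    }

  module _ (H : IsHemiNelson A) where
    module H = IsHemiNelson H
    open IsDistributiveLattice (IsKleene.isDistributiveLattice H.isKleene)
      using (isLattice)

    lattice : Lattice _ _
    lattice = record { isLattice = isLattice }

    ⊓-commutativeSemigroup : CommutativeSemigroup _ _
    ⊓-commutativeSemigroup = record
      { isCommutativeSemigroup =
          IsCommutativeBand.isCommutativeSemigroup (LatticeProperties.∧-isSemilattice lattice)
      }

    open CommutativeSemigroup ⊓-commutativeSemigroup using (assoc; comm)
    open CommutativeSemigroupProperties ⊓-commutativeSemigroup using (xy∙z≈xz∙y; xy∙z≈x∙zy)

    infix 4 _≋_
    _≋_ : Carrier → Carrier → Set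
    x ≋ y = (x ⇒ y ≡ 𝟙) × (y ⇒ x ≡ 𝟙)

    ≋-setoid : Setoid _ _
    ≋-setoid = record
      { _≈_           = _≋_
      ; isEquivalence = record
        { refl  = λ {x} → H.hN1 x , H.hN1 x
        ; sym   = swap
        ; trans = λ {x} {y} {z} (p , q) (r , s) → H.hN7 x y z p q r s
        }
      }

    open SetoidReasoning ≋-setoid

    ⊓-congʳ-≋ : ∀ {u v} w → u ≋ v → u ⊓ w ≋ v ⊓ w
    ⊓-congʳ-≋ {u} {v} w (p , q) = H.hN8 u v w p q , H.hN8 v u w q p

    ⊓⇔-≋-⊓⊓⇔ : ∀ x y → x ⊓ (x ⇔ y) ≋ (x ⊓ y) ⊓ (x ⇔ y)
    ⊓⇔-≋-⊓⊓⇔ x y = begin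
      x ⊓ (x ⇔ y)                   ≡⟨ assoc x (x ⇒ y) (y ⇒ x) ⟨
      (x ⊓ (x ⇒ y)) ⊓ (y ⇒ x)       ≈⟨ ⊓-congʳ-≋ (y ⇒ x) (H.hN6 x y , H.hN5 x y) ⟩
      (x ⊓ y ⊓ (x ⇒ y)) ⊓ (y ⇒ x)   ≡⟨ cong (_⊓ (y ⇒ x)) (assoc x y (x ⇒ y)) ⟨
      ((x ⊓ y) ⊓ (x ⇒ y)) ⊓ (y ⇒ x) ≡⟨ assoc (x ⊓ y) (x ⇒ y) (y ⇒ x) ⟩
      (x ⊓ y) ⊓ (x ⇔ y)             ∎

    ⊓⇔-≋ : ∀ x y → x ⊓ (x ⇔ y) ≋ y ⊓ (x ⇔ y)
    ⊓⇔-≋ x y = begin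
      x ⊓ (x ⇔ y)       ≈⟨ ⊓⇔-≋-⊓⊓⇔ x y ⟩
      (x ⊓ y) ⊓ (x ⇔ y) ≡⟨ cong₂ _⊓_ (comm x y) (comm (x ⇒ y) (y ⇒ x)) ⟩
      (y ⊓ x) ⊓ (y ⇔ x) ≈⟨ ⊓⇔-≋-⊓⊓⇔ y x ⟨
      y ⊓ (y ⇔ x)       ≡⟨ cong (y ⊓_) (comm (y ⇒ x) (x ⇒ y)) ⟩
      y ⊓ (x ⇔ y)       ∎

    ⊓⇔⊓⇔-≋ : ∀ x y z → x ⊓ ((x ⇔ y) ⊓ (y ⇔ z)) ≋ z ⊓ ((x ⇔ y) ⊓ (y ⇔ z))
    ⊓⇔⊓⇔-≋ x y z = begin
      x ⊓ ((x ⇔ y) ⊓ (y ⇔ z)) ≡⟨ assoc x (x ⇔ y) (y ⇔ z) ⟨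
      (x ⊓ (x ⇔ y)) ⊓ (y ⇔ z) ≈⟨ ⊓-congʳ-≋ (y ⇔ z) (⊓⇔-≋ x y) ⟩
      (y ⊓ (x ⇔ y)) ⊓ (y ⇔ z) ≡⟨ xy∙z≈xz∙y y (x ⇔ y) (y ⇔ z) ⟩
      (y ⊓ (y ⇔ z)) ⊓ (x ⇔ y) ≈⟨ ⊓-congʳ-≋ (x ⇔ y) (⊓⇔-≋ y z) ⟩
      (z ⊓ (y ⇔ z)) ⊓ (x ⇔ y) ≡⟨ xy∙z≈x∙zy z (y ⇔ z) (x ⇔ y) ⟩
      z ⊓ ((x ⇔ y) ⊓ (y ⇔ z)) ∎

    isHemiNelson⇒⊨hemiNelsonIdentity : ∀ ax → A ⊨ hemiNelsonIdentity ax
    isHemiNelson⇒⊨hemiNelsonIdentity hN1   ρ = H.hN1 _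
    isHemiNelson⇒⊨hemiNelsonIdentity hN2   ρ = H.hN2 _ _
    isHemiNelson⇒⊨hemiNelsonIdentity hN3   ρ = H.hN3 _ _
    isHemiNelson⇒⊨hemiNelsonIdentity hN4   ρ = H.hN4 _ _
    isHemiNelson⇒⊨hemiNelsonIdentity hN5   ρ = H.hN5 _ _
    isHemiNelson⇒⊨hemiNelsonIdentity hN6   ρ = H.hN6 _ _
    isHemiNelson⇒⊨hemiNelsonIdentity hN7₁  ρ = proj₁ (⊓⇔⊓⇔-≋ (ρ 0) (ρ 1) (ρ 2))
    isHemiNelson⇒⊨hemiNelsonIdentity hN7₂  ρ = proj₂ (⊓⇔⊓⇔-≋ (ρ 0) (ρ 1) (ρ 2))
    isHemiNelson⇒⊨hemiNelsonIdentity hN8   ρ = uncurry (H.hN8 _ _ (ρ 2)) (⊓⇔-≋ (ρ 0) (ρ 1))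
    isHemiNelson⇒⊨hemiNelsonIdentity hN9   ρ = uncurry (H.hN9 _ _ (ρ 2)) (⊓⇔-≋ (ρ 0) (ρ 1))
    isHemiNelson⇒⊨hemiNelsonIdentity hN10₁ ρ = proj₁ (uncurry (H.hN10 _ _ (ρ 2)) (⊓⇔-≋ (ρ 0) (ρ 1)))
    isHemiNelson⇒⊨hemiNelsonIdentity hN10₂ ρ = proj₂ (uncurry (H.hN10 _ _ (ρ 2)) (⊓⇔-≋ (ρ 0) (ρ 1)))

  module _ (K : IsKleene A) where
    ⊓-identityʳ : ∀ x → x ⊓ 𝟙 ≡ x
    ⊓-identityʳ = proj₂ (IsKleene.⊓-identity K)

    ⊓-≡-𝟙 : ∀ {a b} → a ≡ 𝟙 → b ≡ 𝟙 → a ⊓ b ≡ 𝟙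
    ⊓-≡-𝟙 refl refl = ⊓-identityʳ 𝟙

    unguard : ∀ (P : Carrier → Carrier → Set) {x y g} → g ≡ 𝟙 → P (x ⊓ g) (y ⊓ g) → P x y
    unguard P refl = subst₂ P (⊓-identityʳ _) (⊓-identityʳ _)

    ⊨hemiNelsonIdentity⇒isHemiNelson : (∀ ax → A ⊨ hemiNelsonIdentity ax) → IsHemiNelson A
    ⊨hemiNelsonIdentity⇒isHemiNelson M = record
      { isKleene = K
      ; hN1  = λ x → M hN1 (assign x x x)
      ; hN2  = λ x y → M hN2 (assign x y y)
      ; hN3  = λ x y → M hN3 (assign x y y)
      ; hN4  = λ x y → M hN4 (assign x y y)
      ; hN5  = λ x y → M hN5 (assign x y y)
      ; hN6  = λ x y → M hN6 (assign x y y)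
      ; hN7  = λ x y z p q r s →
          let guard≡𝟙 = ⊓-≡-𝟙 (⊓-≡-𝟙 p q) (⊓-≡-𝟙 r s) in
            unguard (λ u v → u ⇒ v ≡ 𝟙) guard≡𝟙 (M hN7₁ (assign x y z))
          , unguard (λ u v → u ⇒ v ≡ 𝟙) guard≡𝟙 (M hN7₂ (assign x y z))
      ; hN8  = λ x y z p q →
          unguard (λ u v → (u ⊓ z) ⇒ (v ⊓ z) ≡ 𝟙) (⊓-≡-𝟙 p q) (M hN8 (assign x y z))
      ; hN9  = λ x y z p q →
          unguard (λ u v → (u ⊔ z) ⇒ (v ⊔ z) ≡ 𝟙) (⊓-≡-𝟙 p q) (M hN9 (assign x y z))
      ; hN10 = λ x y z p q →
            unguard (λ u v → (u ⇒ z) ⇒ (v ⇒ z) ≡ 𝟙) (⊓-≡-𝟙 p q) (M hN10₁ (assign x y z))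
          , unguard (λ u v → (z ⇒ u) ⇒ (z ⇒ v) ≡ 𝟙) (⊓-≡-𝟙 p q) (M hN10₂ (assign x y z))
      }

theorem15 : IsVariety IsHemiNelson
theorem15 = Axiom , axiomIdentity , λ A → sound A , complete A
  where
  sound : ∀ A → IsHemiNelson A → ∀ ax → A ⊨ axiomIdentity ax
  sound A H (inj₁ ax) = isKleene⇒⊨kleeneIdentity A (IsHemiNelson.isKleene H) ax
  sound A H (inj₂ ax) = isHemiNelson⇒⊨hemiNelsonIdentity A H ax

  complete : ∀ A → (∀ ax → A ⊨ axiomIdentity ax) → IsHemiNelson A
  complete A M = ⊨hemiNelsonIdentity⇒isHemiNelson A (⊨kleeneIdentity⇒isKleene A (M ∘ inj₁)) (M ∘ inj₂)
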